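{- Let $d\ge 1$ and $n$ be such that $2^d+d=n/2$. Then every deterministic OBDD (with any variable order) computing $\mathtt{SSA}_n$ has width at least $2^{2^d}$, i.e. $\mathsf{OBDD}(\mathtt{SSA}_n)\ge 2^{2^d}$.
   Context: Shuffled Storage Access function $\mathtt{SSA}_n:\{0,1\}^n\to\{0,1\}$ ($n$ even, $2^d+d=n/2$): for input $x$, let $I_0=(2i_1<\dots<2i_m)$ be the sorted list of even indices $2i$ with $x_{2i-1}=0$ and $I_1=(2j_1<\dots<2j_k)$ the sorted list of even indices $2i$ with $x_{2i-1}=1$. Let $\mathtt{ShiftX}((a_1,\dots,a_t),b)=(a_2,\dots,a_t,a_1\oplus b)$. Start with $\alpha=0^{2^d}$ and for $r=1,\dots,m$ set $\alpha:=\mathtt{ShiftX}(\alpha,x_{2i_r})$; start with $\beta=0^d$ and for $r=1,\dots,k$ set $\beta:=\mathtt{ShiftX}(\beta,x_{2j_r})$. Then $\mathtt{SSA}_n(x)=\mathtt{SA}_d(\alpha,\beta)$, where the storage access function $\mathtt{SA}_d(\alpha,\beta)$ returns the bit of the storage $\alpha\in\{0,1\}^{2^d}$ at the address encoded in binary by $\beta\in\{0,1\}^d$. A deterministic OBDD of width $m$ over $x_1,\dots,x_n$ consists of a permutation $\pi$ of $\{1,\dots,n\}$, a set $S$ of $m$ states, an initial state, maps $T_j^0,T_j^1:S\to S$ for each step $j$, and an accepting set; on input $x$ it applies $T_j^{x_{\pi(j)}}$ at step $j$ starting from the initial state and outputs $1$ iff the final state is accepting. $\mathsf{OBDD}(f)$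 is the minimum width over all such OBDDs computing $f$. -}

module Defs where

open import Data.Nat using (ℕ; zero; suc; _+_; _*_; _^_)
open import Data.Bool using (Bool; true; false; _xor_; if_then_else_)
open import Data.List using (List; []; _∷_; _++_; [_]; foldl; tabulate; allFin)
open import Data.Fin using (Fin)
open import Data.Product using (_×_; _,_; proj₁; proj₂)
open import Data.Fin.Permutation using (Permutation′; _⟨$⟩ʳ_)
open import Relation.Binary.PropositionalEquality using (_≡_)

shiftX : List Bool → Bool → List Bool
shiftX []       b = []
shiftX (a ∷ as) b = as ++ [ a xor b ]

replicateFalse : ℕ → List Bool
replicateFalse zero    = []
replicateFalse (suc k) = false ∷ replicateFalse k

bin : List Bool → ℕ
bin = foldl (λ acc b → 2 * acc + (if b then 1 else 0)) 0

-- the i-th entry (0-based) of a list, false if out of range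
nth : List Bool → ℕ → Bool
nth []       _       = false
nth (a ∷ as) zero    = a
nth (a ∷ as) (suc i) = nth as i

-- storage access: bit of α at address β (α₁ is address 0)
SA : List Bool → List Bool → Bool
SA α β = nth α (bin β)

processPairs : List Bool → List Bool × List Bool → List Bool × List Bool
processPairs (s ∷ v ∷ rest) (α , β) =
  processPairs rest (if s then (α , shiftX β v) else (shiftX α v , β))
processPairs _ st = st

-- SSA_n for n = 2 (2^d + d); input bits x₁,…,x_n are x 0, …, x (n-1)
SSA : (d : ℕ) → (Fin (2 * (2 ^ d + d)) → Bool) → Bool
SSA d x =
  let st = processPairs (tabulate x) (replicateFalse (2 ^ d) , replicateFalse d)
  in SA (proj₁ st) (proj₂ st)

-- deterministic OBDD of width m over n variables (state set Fin m)
record OBDD (n m : ℕ) : Set where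
  field
    order  : Permutation′ n
    init   : Fin m
    trans  : Fin n → Bool → Fin m → Fin m
    accept : Fin m → Bool

runOBDD : ∀ {n m} → OBDD n m → (Fin n → Bool) → Bool
runOBDD {n} B x =
  OBDD.accept B
    (foldl (λ q j → OBDD.trans B j (x (OBDD.order B ⟨$⟩ʳ j)) q) (OBDD.init B) (allFin n))

Computes : ∀ {n m} → OBDD n m → ((Fin n → Bool) → Bool) → Set
Computes B f = ∀ x → runOBDD B x ≡ f x

-- Cut the variable order after a step t at which exactly 2^d of the data bits x_{2i} have
-- been read; such t exists because this count grows by at most one per step, from 0 to 2^d + d.
-- Choose the selector bits so that the early data bits are shifted into the storage α and the
-- late ones into the address β.  The part of the OBDD after the cut can then read any bit of
-- the storage written before the cut, so the 2^{2^d} storages reach pairwise distinct states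
-- at step t.
module Submission where

open import Defs
open import Data.Nat using (ℕ; zero; suc; _+_; _*_; _^_; _≤_; _<_; _<ᵇ_; z≤n; s≤s; z<s; s<s)
open import Data.Nat.Properties
open import Data.Nat.DivMod using (_/_; _mod_; _divMod_; DivMod; m<n*o⇒m/o<n)
open import Data.Bool using (Bool; true; false; if_then_else_)
open import Data.Bool.Properties using (if-eta)
open import Data.List using (List; []; _∷_; _++_; [_]; _∷ʳ_; foldl; length; map; tabulate; allFin; take; drop)
open import Data.List.Properties
  using ( foldl-∷ʳ; foldl-++; length-++; length-map; length-tabulate; map-tabulate
        ; take-map; drop-map; take++drop≡id; ++-assoc; ++-identityʳ)
open import Data.List.Relation.Unary.All as All using (All; []; _∷_)
open import Data.List.Relation.Unary.All.Properties using (map⁺) renaming (tabulate⁺ to All-tabulate⁺)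
open import Data.List.Relation.Unary.AllPairs using ([]; _∷_)
open import Data.List.Relation.Unary.Unique.Propositional using (Unique)
open import Data.List.Relation.Unary.Unique.Propositional.Properties
  using () renaming (tabulate⁺ to Unique-tabulate⁺)
open import Data.Fin as Fin using (Fin; toℕ)
open import Data.Fin.Properties using (toℕ-injective; toℕ<n; injective⇒≤)
open import Data.Fin.Permutation using (_⟨$⟩ʳ_; _⟨$⟩ˡ_; inverseˡ; inverseʳ)
open import Data.Product using (_×_; _,_; proj₁; proj₂; ∃-syntax; uncurry)
open import Function using (_∘_)
open import Relation.Nullary using (yes; no; contradiction)
open import Relation.Binary.PropositionalEquality
  using (_≡_; _≢_; refl; sym; trans; cong; cong₂; subst; module ≡-Reasoning)

private
  variable
    A B : Set

bit : Fin 2 → Bool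
bit Fin.zero           = false
bit (Fin.suc Fin.zero) = true

bit-value : ∀ r → (if bit r then 1 else 0) ≡ toℕ r
bit-value Fin.zero           = refl
bit-value (Fin.suc Fin.zero) = refl

bin-surjective : ∀ d p → p < 2 ^ d → ∃[ bs ] length bs ≡ d × bin bs ≡ p
bin-surjective zero    zero    _          = [] , refl , refl
bin-surjective zero    (suc p) (s≤s ())
bin-surjective (suc d) p       p<2^1+d
  with bin-surjective d (p / 2) (m<n*o⇒m/o<n (subst (p <_) (*-comm 2 (2 ^ d)) p<2^1+d))
... | bs , |bs|≡d , bin-bs≡p/2 =
  bs ∷ʳ bit (p mod 2) ,
  trans (length-++ bs) (trans (cong (_+ 1) |bs|≡d) (+-comm d 1)) ,
  (begin
    bin (bs ∷ʳ bit (p mod 2))                        ≡⟨ foldl-∷ʳ _ 0 (bit (p mod 2)) bs ⟩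
    2 * bin bs + (if bit (p mod 2) then 1 else 0)    ≡⟨ cong₂ _+_ (cong (2 *_) bin-bs≡p/2) (bit-value (p mod 2)) ⟩
    2 * (p / 2) + toℕ (p mod 2)                      ≡⟨ +-comm (2 * (p / 2)) _ ⟩
    toℕ (p mod 2) + 2 * (p / 2)                      ≡⟨ cong (toℕ (p mod 2) +_) (*-comm 2 (p / 2)) ⟩
    toℕ (p mod 2) + p / 2 * 2                        ≡⟨ sym (DivMod.property (p divMod 2)) ⟩
    p                                                ∎)
  where open ≡-Reasoning

trues : List Bool → ℕ
trues []           = 0
trues (true  ∷ bs) = suc (trues bs)
trues (false ∷ bs) = trues bs

falses : List Bool → ℕ
falses []           = 0
falses (true  ∷ bs) = falses bs
falses (false ∷ bs) = suc (falses bs)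

trues+falses≡length : ∀ bs → trues bs + falses bs ≡ length bs
trues+falses≡length []           = refl
trues+falses≡length (true  ∷ bs) = cong suc (trues+falses≡length bs)
trues+falses≡length (false ∷ bs) = trans (+-suc (trues bs) (falses bs)) (cong suc (trues+falses≡length bs))

odds : List A → List A
odds (_ ∷ y ∷ xs) = y ∷ odds xs
odds _            = []

length-odds : ∀ k (xs : List A) → length xs ≡ 2 * k → length (odds xs) ≡ k
length-odds zero    []           _ = refl
length-odds (suc k) (_ ∷ [])     eq = contradiction (trans eq (*-suc 2 k)) λ ()
length-odds (suc k) (_ ∷ _ ∷ xs) eq =
  cong suc (length-odds k xs (suc-injective (suc-injective (trans eq (*-suc 2 k)))))

odds-map : ∀ (f : A → B) xs → odds (map f xs) ≡ map f (odds xs)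
odds-map f []           = refl
odds-map f (_ ∷ [])     = refl
odds-map f (_ ∷ y ∷ xs) = cong (f y ∷_) (odds-map f xs)

All-odds : ∀ {P : A → Set} {xs} → All P xs → All P (odds xs)
All-odds []               = []
All-odds (_ ∷ [])         = []
All-odds (_ ∷ py ∷ pxs)   = py ∷ All-odds pxs

Unique-odds : ∀ {xs : List A} → Unique xs → Unique (odds xs)
Unique-odds []                = []
Unique-odds (_ ∷ [])          = []
Unique-odds (_ ∷ y∉xs ∷ uniq) = All-odds y∉xs ∷ Unique-odds uniq

<⇒<ᵇ≡true : ∀ {p t} → p < t → (p <ᵇ t) ≡ true
<⇒<ᵇ≡true {zero}  {suc t} _           = refl
<⇒<ᵇ≡true {suc p} {suc t} (s≤s p<t)   = <⇒<ᵇ≡true p<t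

≥⇒<ᵇ≡false : ∀ {p t} → t ≤ p → (p <ᵇ t) ≡ false
≥⇒<ᵇ≡false {p}     {zero}  _          = refl
≥⇒<ᵇ≡false {suc p} {suc t} (s≤s t≤p)  = ≥⇒<ᵇ≡false t≤p

<ᵇ-suc-≢ : ∀ {p t} → p ≢ t → (p <ᵇ suc t) ≡ (p <ᵇ t)
<ᵇ-suc-≢ {zero}  {zero}  p≢t = contradiction refl p≢t
<ᵇ-suc-≢ {zero}  {suc t} _   = refl
<ᵇ-suc-≢ {suc p} {zero}  _   = refl
<ᵇ-suc-≢ {suc p} {suc t} p≢t = <ᵇ-suc-≢ (p≢t ∘ cong suc)

countBelow : ℕ → List ℕ → ℕ
countBelow t ps = trues (map (_<ᵇ t) ps)

countBelow-zero : ∀ ps → countBelow 0 ps ≡ 0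
countBelow-zero []       = refl
countBelow-zero (_ ∷ ps) = countBelow-zero ps

countBelow-all : ∀ {t ps} → All (_< t) ps → countBelow t ps ≡ length ps
countBelow-all []                                      = refl
countBelow-all (p<t ∷ ps<t) rewrite <⇒<ᵇ≡true p<t = cong suc (countBelow-all ps<t)

map-<ᵇ-suc-∉ : ∀ {t ps} → All (t ≢_) ps → map (_<ᵇ suc t) ps ≡ map (_<ᵇ t) ps
map-<ᵇ-suc-∉ []             = refl
map-<ᵇ-suc-∉ (t≢p ∷ t∉ps)   = cong₂ _∷_ (<ᵇ-suc-≢ (t≢p ∘ sym)) (map-<ᵇ-suc-∉ t∉ps)

countBelow-suc : ∀ t {ps} → Unique ps → countBelow (suc t) ps ≤ suc (countBelow t ps)
countBelow-suc t []                     = z≤n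
countBelow-suc t {p ∷ ps} (p∉ps ∷ uniq) with p ≟ t
... | yes refl rewrite <⇒<ᵇ≡true (n<1+n p) | ≥⇒<ᵇ≡false (≤-refl {p}) =
  s≤s (≤-reflexive (cong trues (map-<ᵇ-suc-∉ p∉ps)))
... | no p≢t rewrite <ᵇ-suc-≢ p≢t with p <ᵇ t
...   | true  = s≤s (countBelow-suc t uniq)
...   | false = countBelow-suc t uniq

discrete-ivt : (c : ℕ → ℕ) → (∀ t → c (suc t) ≤ suc (c t)) →
               ∀ {k} s → c 0 ≤ k → k ≤ c s → ∃[ t ] c t ≡ k
discrete-ivt c c-step zero    c0≤k k≤c0 = 0 , ≤-antisym c0≤k k≤c0
discrete-ivt c c-step {k} (suc s) c0≤k k≤c[1+s] with k ≤? c s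
... | yes k≤cs = discrete-ivt c c-step s c0≤k k≤cs
... | no  k≰cs = suc s , ≤-antisym (≤-trans (c-step s) (≰⇒> k≰cs)) k≤c[1+s]

scatter : List Bool → List Bool → List Bool → List Bool
scatter []          a b = []
scatter (true  ∷ E) a b = false ∷ nth a 0 ∷ scatter E (drop 1 a) b
scatter (false ∷ E) a b = true  ∷ nth b 0 ∷ scatter E a (drop 1 b)

length-scatter : ∀ E a b → length (scatter E a b) ≡ 2 * length E
length-scatter []          a b = refl
length-scatter (true  ∷ E) a b =
  trans (cong (suc ∘ suc) (length-scatter E (drop 1 a) b)) (sym (*-suc 2 (length E)))
length-scatter (false ∷ E) a b =
  trans (cong (suc ∘ suc) (length-scatter E a (drop 1 b))) (sym (*-suc 2 (length E)))

processPairs-scatter : ∀ E a b {u v} → trues E ≡ length a → falses E ≡ length b →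
  processPairs (scatter E a b) (replicateFalse (length a) ++ u , replicateFalse (length b) ++ v)
    ≡ (u ++ a , v ++ b)
processPairs-scatter []          []      []      {u} {v} _ _ =
  cong₂ _,_ (sym (++-identityʳ u)) (sym (++-identityʳ v))
processPairs-scatter (true  ∷ E) (x ∷ a) b       {u} {v} |E|₁≡|a| |E|₀≡|b| = begin
    processPairs (scatter E a b) ((replicateFalse (length a) ++ u) ++ [ x ] , replicateFalse (length b) ++ v)
  ≡⟨ cong (λ α → processPairs (scatter E a b) (α , _)) (++-assoc (replicateFalse (length a)) u [ x ]) ⟩
    processPairs (scatter E a b) (replicateFalse (length a) ++ u ++ [ x ] , replicateFalse (length b) ++ v)
  ≡⟨ processPairs-scatter E a b (suc-injective |E|₁≡|a|) |E|₀≡|b| ⟩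
    ((u ++ [ x ]) ++ a , v ++ b)
  ≡⟨ cong (_, v ++ b) (++-assoc u [ x ] a) ⟩
    (u ++ x ∷ a , v ++ b) ∎
  where open ≡-Reasoning
processPairs-scatter (false ∷ E) a       (y ∷ b) {u} {v} |E|₁≡|a| |E|₀≡|b| = begin
    processPairs (scatter E a b) (replicateFalse (length a) ++ u , (replicateFalse (length b) ++ v) ++ [ y ])
  ≡⟨ cong (λ β → processPairs (scatter E a b) (_ , β)) (++-assoc (replicateFalse (length b)) v [ y ]) ⟩
    processPairs (scatter E a b) (replicateFalse (length a) ++ u , replicateFalse (length b) ++ v ++ [ y ])
  ≡⟨ processPairs-scatter E a b |E|₁≡|a| (suc-injective |E|₀≡|b|) ⟩
    (u ++ a , (v ++ [ y ]) ++ b)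
  ≡⟨ cong (u ++ a ,_) (++-assoc v [ y ] b) ⟩
    (u ++ a , v ++ y ∷ b) ∎
  where open ≡-Reasoning

select : List Bool → List A → List A → List A
select (c ∷ cs) (x ∷ xs) (y ∷ ys) = (if c then x else y) ∷ select cs xs ys
select _        _        _        = []

tabulate-if : ∀ {n} (c : Fin n → Bool) (f g : Fin n → A) →
  tabulate (λ i → if c i then f i else g i) ≡ select (tabulate c) (tabulate f) (tabulate g)
tabulate-if {n = zero}  c f g = refl
tabulate-if {n = suc n} c f g = cong ((if c Fin.zero then f Fin.zero else g Fin.zero) ∷_)
                                     (tabulate-if (c ∘ Fin.suc) (f ∘ Fin.suc) (g ∘ Fin.suc))

select-scatter : ∀ M {E} a a′ b b′ → odds M ≡ E →
  select M (scatter E a b′) (scatter E a′ b) ≡ scatter E a b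
select-scatter []               a a′ b b′ refl = refl
select-scatter (_ ∷ [])         a a′ b b′ refl = refl
select-scatter (c ∷ true  ∷ M)  a a′ b b′ refl =
  cong₂ _∷_ (if-eta c) (cong (nth a 0 ∷_) (select-scatter M (drop 1 a) (drop 1 a′) b b′ refl))
select-scatter (c ∷ false ∷ M)  a a′ b b′ refl =
  cong₂ _∷_ (if-eta c) (cong (nth b 0 ∷_) (select-scatter M a a′ (drop 1 b) (drop 1 b′) refl))

tabulate-nth : ∀ {n} L → length L ≡ n → tabulate {n = n} (λ i → nth L (toℕ i)) ≡ L
tabulate-nth {n = zero}  []      _         = refl
tabulate-nth {n = suc n} (x ∷ L) |x∷L|≡1+n = cong (x ∷_) (tabulate-nth L (suc-injective |x∷L|≡1+n))

nth-ext : ∀ {k} L L′ → length L ≡ k → length L′ ≡ k →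
          (∀ (p : Fin k) → nth L (toℕ p) ≡ nth L′ (toℕ p)) → L ≡ L′
nth-ext {zero}  []      []        _    _     _     = refl
nth-ext {suc k} (x ∷ L) (x′ ∷ L′) |L|  |L′|  L≗L′  =
  cong₂ _∷_ (L≗L′ Fin.zero)
            (nth-ext L L′ (suc-injective |L|) (suc-injective |L′|) (L≗L′ ∘ Fin.suc))

foldl-cong-All : ∀ {f g : A → B → A} {xs} → All (λ y → ∀ q → f q y ≡ g q y) xs →
                 ∀ q → foldl f q xs ≡ foldl g q xs
foldl-cong-All []               q = refl
foldl-cong-All {g = g} {xs = y ∷ _} (f≗g ∷ fs≗gs) q rewrite f≗g q = foldl-cong-All fs≗gs (g q y)

map-suc-allFin : ∀ n → map Fin.suc (allFin n) ≡ tabulate Fin.suc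
map-suc-allFin n = map-tabulate (λ i → i) Fin.suc

take-allFin : ∀ n t → All (λ j → toℕ j < t) (take t (allFin n))
take-allFin n       zero    = []
take-allFin zero    (suc t) = []
take-allFin (suc n) (suc t) = z<s ∷ subst (All _)
  (trans (sym (take-map t (allFin n))) (cong (take t) (map-suc-allFin n)))
  (map⁺ (All.map s<s (take-allFin n t)))

drop-allFin : ∀ n t → All (λ j → t ≤ toℕ j) (drop t (allFin n))
drop-allFin n       zero    = All-tabulate⁺ (λ _ → z≤n)
drop-allFin zero    (suc t) = []
drop-allFin (suc n) (suc t) = subst (All _)
  (trans (sym (drop-map t (allFin n))) (cong (drop t) (map-suc-allFin n)))
  (map⁺ (All.map s≤s (drop-allFin n t)))

module _ {n m} (B : OBDD n m) where
  open OBDD B renaming (trans to δ)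

  readTime : Fin n → ℕ
  readTime i = toℕ (order ⟨$⟩ˡ i)

  readTime-injective : ∀ {i j} → readTime i ≡ readTime j → i ≡ j
  readTime-injective {i} {j} eq = begin
    i                           ≡⟨ sym (inverseʳ order) ⟩
    order ⟨$⟩ʳ (order ⟨$⟩ˡ i)   ≡⟨ cong (order ⟨$⟩ʳ_) (toℕ-injective eq) ⟩
    order ⟨$⟩ʳ (order ⟨$⟩ˡ j)   ≡⟨ inverseʳ order ⟩
    j                           ∎
    where open ≡-Reasoning

  step : (Fin n → Bool) → Fin m → Fin n → Fin m
  step x q j = δ j (x (order ⟨$⟩ʳ j)) q

  stateAfter : ℕ → (Fin n → Bool) → Fin m
  stateAfter t x = foldl (step x) init (take t (allFin n))

  splice : ℕ → (Fin n → Bool) → (Fin n → Bool) → Fin n → Bool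
  splice t x y i = if readTime i <ᵇ t then x i else y i

  splice-early : ∀ t x y {j} → toℕ j < t → splice t x y (order ⟨$⟩ʳ j) ≡ x (order ⟨$⟩ʳ j)
  splice-early t x y {j} j<t rewrite inverseˡ order {j} | <⇒<ᵇ≡true j<t = refl

  splice-late : ∀ t x y {j} → t ≤ toℕ j → splice t x y (order ⟨$⟩ʳ j) ≡ y (order ⟨$⟩ʳ j)
  splice-late t x y {j} t≤j rewrite inverseˡ order {j} | ≥⇒<ᵇ≡false t≤j = refl

  runOBDD-splice : ∀ t x y →
    runOBDD B (splice t x y) ≡ accept (foldl (step y) (stateAfter t x) (drop t (allFin n)))
  runOBDD-splice t x y = cong accept (begin
      foldl (step z) init (allFin n)
    ≡⟨ cong (foldl (step z) init) (sym (take++drop≡id t (allFin n))) ⟩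
      foldl (step z) init (take t (allFin n) ++ drop t (allFin n))
    ≡⟨ foldl-++ (step z) init (take t (allFin n)) (drop t (allFin n)) ⟩
      foldl (step z) (foldl (step z) init (take t (allFin n))) (drop t (allFin n))
    ≡⟨ cong (λ q → foldl (step z) q (drop t (allFin n)))
            (foldl-cong-All (All.map (λ j<t q → cong (λ b → δ _ b q) (splice-early t x y j<t))
                                     (take-allFin n t)) init) ⟩
      foldl (step z) (stateAfter t x) (drop t (allFin n))
    ≡⟨ foldl-cong-All (All.map (λ t≤j q → cong (λ b → δ _ b q) (splice-late t x y t≤j))
                               (drop-allFin n t)) (stateAfter t x) ⟩
      foldl (step y) (stateAfter t x) (drop t (allFin n)) ∎)
    where
    open ≡-Reasoning
    z : Fin n → Bool
    z = splice t x y

  runOBDD-splice-cong : ∀ t x x′ y → stateAfter t x ≡ stateAfter t x′ →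
                        runOBDD B (splice t x y) ≡ runOBDD B (splice t x′ y)
  runOBDD-splice-cong t x x′ y same = begin
    runOBDD B (splice t x y)                                       ≡⟨ runOBDD-splice t x y ⟩
    accept (foldl (step y) (stateAfter t x) (drop t (allFin n)))
      ≡⟨ cong (λ q → accept (foldl (step y) q (drop t (allFin n)))) same ⟩
    accept (foldl (step y) (stateAfter t x′) (drop t (allFin n)))  ≡⟨ sym (runOBDD-splice t x′ y) ⟩
    runOBDD B (splice t x′ y)                                      ∎
    where open ≡-Reasoning

module FoolingSet (d : ℕ) {m} (B : OBDD (2 * (2 ^ d + d)) m) where

  -- Variables are 0-based, so the data bits x_{2i} are the odd-numbered ones.
  dataTimes : List ℕ
  dataTimes = odds (tabulate (readTime B))

  length-dataTimes : length dataTimes ≡ 2 ^ d + d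
  length-dataTimes = length-odds (2 ^ d + d) (tabulate (readTime B)) (length-tabulate (readTime B))

  cut : ∃[ t ] countBelow t dataTimes ≡ 2 ^ d
  cut = discrete-ivt (λ t → countBelow t dataTimes)
    (λ t → countBelow-suc t (Unique-odds (Unique-tabulate⁺ (readTime-injective B))))
    (2 * (2 ^ d + d))
    (≤-trans (≤-reflexive (countBelow-zero dataTimes)) z≤n)
    (begin
      2 ^ d                                  ≤⟨ m≤m+n (2 ^ d) d ⟩
      2 ^ d + d                              ≡⟨ sym length-dataTimes ⟩
      length dataTimes                       ≡⟨ sym (countBelow-all (All-odds (All-tabulate⁺ read<n))) ⟩
      countBelow (2 * (2 ^ d + d)) dataTimes ∎)
    where
    open ≤-Reasoning
    read<n : ∀ i → readTime B i < 2 * (2 ^ d + d)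
    read<n i = toℕ<n (OBDD.order B ⟨$⟩ˡ i)

  t : ℕ
  t = proj₁ cut

  E : List Bool
  E = map (_<ᵇ t) dataTimes

  trues-E : trues E ≡ 2 ^ d
  trues-E = proj₂ cut

  falses-E : falses E ≡ d
  falses-E = +-cancelˡ-≡ (2 ^ d) (falses E) d (begin
    2 ^ d + falses E     ≡⟨ cong (_+ falses E) (sym trues-E) ⟩
    trues E + falses E   ≡⟨ trues+falses≡length E ⟩
    length E             ≡⟨ length-map (_<ᵇ t) dataTimes ⟩
    length dataTimes     ≡⟨ length-dataTimes ⟩
    2 ^ d + d            ∎)
    where open ≡-Reasoning

  odds-readBefore : odds (tabulate (λ i → readTime B i <ᵇ t)) ≡ E
  odds-readBefore = trans (cong odds (sym (map-tabulate (readTime B) (_<ᵇ t)))) (odds-map (_<ᵇ t) _)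

  storage : Fin (2 ^ 2 ^ d) → List Bool
  storage a = proj₁ (bin-surjective (2 ^ d) (toℕ a) (toℕ<n a))

  address : Fin (2 ^ d) → List Bool
  address p = proj₁ (bin-surjective d (toℕ p) (toℕ<n p))

  length-storage : ∀ a → length (storage a) ≡ 2 ^ d
  length-storage a = proj₁ (proj₂ (bin-surjective (2 ^ d) (toℕ a) (toℕ<n a)))

  bin-storage : ∀ a → bin (storage a) ≡ toℕ a
  bin-storage a = proj₂ (proj₂ (bin-surjective (2 ^ d) (toℕ a) (toℕ<n a)))

  length-address : ∀ p → length (address p) ≡ d
  length-address p = proj₁ (proj₂ (bin-surjective d (toℕ p) (toℕ<n p)))

  bin-address : ∀ p → bin (address p) ≡ toℕ p
  bin-address p = proj₂ (proj₂ (bin-surjective d (toℕ p) (toℕ<n p)))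

  storage-injective : ∀ {a a′} →
    (∀ p → nth (storage a) (toℕ p) ≡ nth (storage a′) (toℕ p)) → a ≡ a′
  storage-injective {a} {a′} same = toℕ-injective (begin
    toℕ a             ≡⟨ sym (bin-storage a) ⟩
    bin (storage a)
      ≡⟨ cong bin (nth-ext (storage a) (storage a′) (length-storage a) (length-storage a′) same) ⟩
    bin (storage a′)  ≡⟨ bin-storage a′ ⟩
    toℕ a′            ∎)
    where open ≡-Reasoning

  fromList : List Bool → Fin (2 * (2 ^ d + d)) → Bool
  fromList L i = nth L (toℕ i)

  storageInput : Fin (2 ^ 2 ^ d) → Fin (2 * (2 ^ d + d)) → Bool
  storageInput a = fromList (scatter E (storage a) [])

  addressInput : Fin (2 ^ d) → Fin (2 * (2 ^ d + d)) → Bool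
  addressInput p = fromList (scatter E [] (address p))

  tabulate-fromList-scatter : ∀ a b → tabulate (fromList (scatter E a b)) ≡ scatter E a b
  tabulate-fromList-scatter a b = tabulate-nth (scatter E a b)
    (trans (length-scatter E a b) (cong (2 *_) (trans (length-map (_<ᵇ t) dataTimes) length-dataTimes)))

  SSA-splice : ∀ a p → SSA d (splice B t (storageInput a) (addressInput p)) ≡ nth (storage a) (toℕ p)
  SSA-splice a p = begin
      SSA d (splice B t (storageInput a) (addressInput p))
    ≡⟨ cong (λ L → uncurry SA (processPairs L (replicateFalse (2 ^ d) , replicateFalse d))) spliced ⟩
      uncurry SA (processPairs (scatter E α β) (replicateFalse (2 ^ d) , replicateFalse d))
    ≡⟨ cong (λ st → uncurry SA (processPairs (scatter E α β) st)) registers ⟩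
      uncurry SA (processPairs (scatter E α β)
                               (replicateFalse (length α) ++ [] , replicateFalse (length β) ++ []))
    ≡⟨ cong (uncurry SA) (processPairs-scatter E α β (trans trues-E (sym (length-storage a)))
                                                     (trans falses-E (sym (length-address p)))) ⟩
      nth α (bin β)
    ≡⟨ cong (nth α) (bin-address p) ⟩
      nth α (toℕ p) ∎
    where
    open ≡-Reasoning
    α β : List Bool
    α = storage a
    β = address p
    spliced : tabulate (splice B t (storageInput a) (addressInput p)) ≡ scatter E α β
    spliced = begin
      tabulate (splice B t (storageInput a) (addressInput p))
        ≡⟨ tabulate-if _ (storageInput a) (addressInput p) ⟩
      select (tabulate (λ i → readTime B i <ᵇ t)) (tabulate (storageInput a)) (tabulate (addressInput p))
        ≡⟨ cong₂ (select _) (tabulate-fromList-scatter α []) (tabulate-fromList-scatter [] β) ⟩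
      select (tabulate (λ i → readTime B i <ᵇ t)) (scatter E α []) (scatter E [] β)
        ≡⟨ select-scatter _ α [] β [] odds-readBefore ⟩
      scatter E α β ∎
    registers : (replicateFalse (2 ^ d) , replicateFalse d)
              ≡ (replicateFalse (length α) ++ [] , replicateFalse (length β) ++ [])
    registers = cong₂ _,_
      (trans (cong replicateFalse (sym (length-storage a))) (sym (++-identityʳ _)))
      (trans (cong replicateFalse (sym (length-address p))) (sym (++-identityʳ _)))

theorem5 : (d : ℕ) → 1 ≤ d → (m : ℕ) → (B : OBDD (2 * (2 ^ d + d)) m) →
    Computes B (SSA d) → 2 ^ (2 ^ d) ≤ m
theorem5 d _ m B computes = injective⇒≤ stateAfter-injective
  where
  open FoolingSet d B
  stateAfter-injective : ∀ {a a′} →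
    stateAfter B t (storageInput a) ≡ stateAfter B t (storageInput a′) → a ≡ a′
  stateAfter-injective {a} {a′} same = storage-injective λ p → begin
    nth (storage a) (toℕ p)                                   ≡⟨ sym (SSA-splice a p) ⟩
    SSA d (splice B t (storageInput a) (addressInput p))      ≡⟨ sym (computes _) ⟩
    runOBDD B (splice B t (storageInput a) (addressInput p))
      ≡⟨ runOBDD-splice-cong B t (storageInput a) (storageInput a′) (addressInput p) same ⟩
    runOBDD B (splice B t (storageInput a′) (addressInput p)) ≡⟨ computes _ ⟩
    SSA d (splice B t (storageInput a′) (addressInput p))     ≡⟨ SSA-splice a′ p ⟩
    nth (storage a′) (toℕ p)                                  ∎
    where open ≡-Reasoning
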